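{- Let $G$ be a finite, simple, connected graph on $n$ vertices. Then $\Sigma^{ - }(G)=\{\sigma^{ - }(G)\}$ if and only if $G$ is either the star $K_{1,n-1}$ with $n$ even, or the complete graph $K_n$.
   Context: A signed graph $(G,\sigma)$ is a graph $G$ with a map $\sigma:E(G)\to\{1,-1\}$; an edge $e$ is negative if $\sigma(e)=-1$ and positive otherwise. $(G,\sigma)$ with $G$ on $n$ vertices is a parity signed graph (and $\sigma$ a parity-signature of $G$) if there is a bijection $f:V(G)\to\{1,\dots,n\}$ such that for every edge $uv$, $f(u),f(v)$ have the same parity if $\sigma(uv)=1$ and opposite parities if $\sigma(uv)=-1$. Equivalently, $V(G)$ can be partitioned into two sets $V_1,V_2$ with $||V_1|-|V_2||\le 1$ such that an edge is positive iff its ends lie in the same set. $\Sigma^{ - }(G)$ is the set of numbers of negative edges of $(G,\sigma)$ over all parity-signatures $\sigma$ of $G$, and the $rna$ number is $\sigma^{ - }(G)=\min\Sigma^{ - }(G)$. -}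

module Defs where

open import Data.Nat using (ℕ; zero; suc; _+_; _≤_; _⊓_; _<ᵇ_)
open import Data.Bool using (Bool; true; false; _∧_; not; if_then_else_; _xor_)
open import Data.Fin using (Fin; toℕ; _≟_)
import Data.Fin as F
open import Data.Vec using (Vec; []; _∷_; lookup)
open import Data.List using (List; []; _∷_; map; filter; foldr; _++_)
open import Data.Product using (Σ; _×_; _,_)
open import Relation.Binary.PropositionalEquality using (_≡_)
open import Relation.Nullary using (¬_; does)
open import Relation.Nullary.Decidable using (⌊_⌋)
open import Function.Bundles using (_↔_; Inverse)
open import Data.Nat.Properties using (_≤?_)

record Graph (n : ℕ) : Set where
  field
    adj       : Fin n → Fin n → Bool
    adj-sym   : ∀ u v → adj u v ≡ adj v u
    adj-irrefl : ∀ u → adj u u ≡ false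
open Graph public

sumFin : ∀ {n} → (Fin n → ℕ) → ℕ
sumFin {zero}  f = 0
sumFin {suc n} f = f F.zero + sumFin (λ i → f (F.suc i))

b2n : Bool → ℕ
b2n true  = 1
b2n false = 0

countFin : ∀ {n} → (Fin n → Bool) → ℕ
countFin p = sumFin (λ i → b2n (p i))

countPairs : ∀ {n} → (Fin n → Fin n → Bool) → ℕ
countPairs {n} p = sumFin (λ i → countFin (λ j → (toℕ i <ᵇ toℕ j) ∧ p i j))

-- A partition of V(G) into V₁ (true) and V₂ (false).
Partition : ℕ → Set
Partition n = Fin n → Bool

Balanced : ∀ {n} → Partition n → Set
Balanced {n} P = (countFin P ≤ countFin (λ i → not (P i)) + 1)
               × (countFin (λ i → not (P i)) ≤ countFin P + 1)

-- number of negative edges of the parity signature induced by P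
-- (edges whose ends lie in different sets)
negEdges : ∀ {n} → Graph n → Partition n → ℕ
negEdges G P = countPairs (λ u v → adj G u v ∧ (P u xor P v))

InΣ⁻ : ∀ {n} → Graph n → ℕ → Set
InΣ⁻ {n} G k = Σ (Partition n) λ P → Balanced P × (negEdges G P ≡ k)

-- computable enumeration of all partitions, to define the minimum σ⁻(G)
allVecs : (n : ℕ) → List (Vec Bool n)
allVecs zero    = [] ∷ []
allVecs (suc n) = map (true ∷_) (allVecs n) ++ map (false ∷_) (allVecs n)

edgeCount : ∀ {n} → Graph n → ℕ
edgeCount G = countPairs (adj G)

balanced? : ∀ {n} → Vec Bool n → Bool
balanced? v = ⌊ countFin (lookup v) ≤? countFin (λ i → not (lookup v i)) + 1 ⌋
            ∧ ⌊ countFin (λ i → not (lookup v i)) ≤? countFin (lookup v) + 1 ⌋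

-- rna number σ⁻(G) = min Σ⁻(G).  (edgeCount G is only a fold seed: it is an
-- upper bound for every negEdges value, and balanced partitions always exist.)
rna : ∀ {n} → Graph n → ℕ
rna {n} G = foldr _⊓_ (edgeCount G)
              (map (λ v → negEdges G (lookup v)) (filter (λ v → balanced? v ≟b true) (allVecs n)))
  where
  open import Data.Bool.Properties using () renaming (_≟_ to _≟b_)

data Walk {n} (G : Graph n) : Fin n → Fin n → Set where
  here  : ∀ {u} → Walk G u u
  step  : ∀ {u w v} → adj G u w ≡ true → Walk G w v → Walk G u v

Connected : ∀ {n} → Graph n → Set
Connected {n} G = ∀ (u v : Fin n) → Walk G u v

_≅_ : ∀ {n} → Graph n → Graph n → Set
_≅_ {n} G H = Σ (Fin n ↔ Fin n) λ f →
  ∀ u v → adj G u v ≡ adj H (Inverse.to f u) (Inverse.to f v)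

private
  neq : ∀ {n} → Fin n → Fin n → Bool
  neq u v = not (does (u ≟ v))

complete : (n : ℕ) → Graph n
complete n = record { adj = neq ; adj-sym = sym' ; adj-irrefl = irr }
  where
  open import Relation.Binary.PropositionalEquality using (refl; cong)
  open import Relation.Nullary using (yes; no)
  sym' : ∀ u v → neq u v ≡ neq v u
  sym' u v with u ≟ v | v ≟ u
  ... | yes _ | yes _ = refl
  ... | no _  | no _  = refl
  ... | yes p | no q  = Data.Empty.⊥-elim (q (Relation.Binary.PropositionalEquality.sym p))
    where import Data.Empty
  ... | no p  | yes q = Data.Empty.⊥-elim (p (Relation.Binary.PropositionalEquality.sym q))
    where import Data.Empty
  irr : ∀ u → neq u u ≡ false
  irr u with u ≟ u
  ... | yes _ = refl
  ... | no p  = Data.Empty.⊥-elim (p refl)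
    where import Data.Empty

isCentre : ∀ {n} → Fin n → Bool
isCentre u = toℕ u Data.Nat.≡ᵇ 0
  where import Data.Nat

star : (n : ℕ) → Graph n
star n = record { adj = sadj ; adj-sym = ssym ; adj-irrefl = sirr }
  where
  open import Relation.Binary.PropositionalEquality using (refl)
  open import Data.Bool using (_∨_)
  open import Data.Bool.Properties using (∧-comm; ∨-comm)
  sadj : Fin n → Fin n → Bool
  sadj u v = neq u v ∧ (isCentre u ∨ isCentre v)
  ssym : ∀ u v → sadj u v ≡ sadj v u
  ssym u v rewrite adj-sym (complete n) u v | ∨-comm (isCentre u) (isCentre v) = refl
  sirr : ∀ u → sadj u u ≡ false
  sirr u rewrite adj-irrefl (complete n) u = refl

-- A parity signature is a balanced 2-colouring V = V₁ ⊎ V₂ and its negative edges form the cut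
-- between V₁ and V₂.  Exchanging u ∈ V₁ with v ∈ V₂ toggles every edge at u or v except uv, so if
-- all balanced cuts have the same size then, with a the adjacency indicator and d(t,S) the number
-- of neighbours of t in S,
--   d(u,V₁) + d(v,V₂) + 2 a(u,v) = d(u,V₂) + d(v,V₁).
-- Comparing this identity for two balanced partitions that differ in the side of one further vertex
-- w (n odd) gives a(u,w) = a(v,w); comparing two that differ by exchanging further vertices w and x
-- (n even) gives a(u,w) + a(v,x) = a(v,w) + a(u,x).  In a connected graph the first identity forces
-- K_n, the second K_n or a star.  Conversely a balanced cut of K_n has |V₁||V₂| edges and one of a
-- star as many as there are vertices opposite the centre; both depend only on n (n even for stars).
module Submission where

open import Data.Bool using (Bool; true; false; not; _∧_; _∨_; _xor_; if_then_else_)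
import Data.Bool.Properties as Bool
open import Data.Bool.Properties using (xor-comm; xor-same; ∧-identityʳ; ∧-zeroʳ; not-involutive; ¬-not)
open import Data.Empty using (⊥-elim)
open import Data.Fin using (Fin; toℕ; punchIn; _≟_) renaming (zero to fz; suc to fs)
open import Data.Fin.Permutation using (Permutation; _⟨$⟩ʳ_; transpose)
open import Data.Fin.Properties using (punchInᵢ≢i; toℕ-injective; any?)
open import Data.List using (_∷_; []; map; filter)
open import Data.List.Membership.Propositional using (_∈_)
open import Data.List.Membership.Propositional.Properties using (∈-map⁺; ∈-++⁺ˡ; ∈-++⁺ʳ; ∈-filter⁺)
open import Data.List.Properties using (foldr-preservesᵇ; foldr-preservesᵒ)
import Data.List.Relation.Unary.All as All
import Data.List.Relation.Unary.All.Properties as All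
open import Data.List.Relation.Unary.Any as Any using (Any; here)
import Data.List.Relation.Unary.Any.Properties as Any
open import Data.Nat using (ℕ; zero; suc; _+_; _*_; _≤_; _<_; z≤n; s≤s; s≤s⁻¹; _<ᵇ_)
open import Data.Nat.Divisibility using (_∣_; divides)
open import Data.Nat.Properties hiding (_≟_)
open import Algebra.Properties.CommutativeMonoid.Sum +-0-commutativeMonoid
  using (sum; ∑-distrib-+; ∑-comm; sum-remove; sum-permute)
open import Data.Nat.Tactic.RingSolver using (solve)
open import Data.Product using (_×_; _,_; ∃; proj₁; proj₂)
open import Data.Sum using (_⊎_; inj₁; inj₂; [_,_]′)
open import Data.Vec as Vec using (Vec; lookup; tabulate)
open import Data.Vec.Functional using (updateAt)
open import Data.Vec.Functional.Properties using (updateAt-updates; updateAt-minimal)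
open import Data.Vec.Properties using (lookup∘tabulate)
open import Function using (_∘_; const; case_of_)
open import Function.Bundles using (_↔_; Inverse; _⇔_; mk⇔; Equivalence)
open import Function.Construct.Identity using (↔-id)
open import Relation.Binary.Definitions using (tri<; tri≈; tri>)
open import Relation.Binary.PropositionalEquality hiding ([_])
open import Relation.Nullary using (Dec; yes; no; does)
open import Relation.Nullary.Decidable using (dec-true; dec-false; does-⇔; ¬?; _×-dec_)
open import Relation.Nullary.Reflects using (ofʸ; ofⁿ)

open import Defs
open ≡-Reasoning

-- Finite sums

sumFin≡sum : ∀ {n} (f : Fin n → ℕ) → sumFin f ≡ sum f
sumFin≡sum {zero}  f = refl
sumFin≡sum {suc n} f = cong (f fz +_) (sumFin≡sum (f ∘ fs))

sumFin-cong : ∀ {n} {f g : Fin n → ℕ} → (∀ i → f i ≡ g i) → sumFin f ≡ sumFin g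
sumFin-cong {zero}  f≗g = refl
sumFin-cong {suc n} f≗g = cong₂ _+_ (f≗g fz) (sumFin-cong (f≗g ∘ fs))

sumFin-mono : ∀ {n} {f g : Fin n → ℕ} → (∀ i → f i ≤ g i) → sumFin f ≤ sumFin g
sumFin-mono {zero}  f≤g = z≤n
sumFin-mono {suc n} f≤g = +-mono-≤ (f≤g fz) (sumFin-mono (f≤g ∘ fs))

sumFin-zero : ∀ n → sumFin {n} (λ _ → 0) ≡ 0
sumFin-zero zero    = refl
sumFin-zero (suc n) = sumFin-zero n

sumFin-distrib-+ : ∀ {n} (f g : Fin n → ℕ) → sumFin (λ i → f i + g i) ≡ sumFin f + sumFin g
sumFin-distrib-+ f g = begin
  sumFin (λ i → f i + g i) ≡⟨ sumFin≡sum (λ i → f i + g i) ⟩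
  sum (λ i → f i + g i)    ≡⟨ ∑-distrib-+ f g ⟩
  sum f + sum g            ≡⟨ cong₂ _+_ (sumFin≡sum f) (sumFin≡sum g) ⟨
  sumFin f + sumFin g      ∎

sumFin-comm : ∀ {m n} (f : Fin m → Fin n → ℕ) →
  sumFin (λ i → sumFin (f i)) ≡ sumFin (λ j → sumFin (λ i → f i j))
sumFin-comm f = begin
  sumFin (λ i → sumFin (f i))         ≡⟨ sumFin≡sum₂ f ⟩
  sum (λ i → sum (f i))               ≡⟨ ∑-comm f ⟩
  sum (λ j → sum (λ i → f i j))       ≡⟨ sumFin≡sum₂ (λ j i → f i j) ⟨
  sumFin (λ j → sumFin (λ i → f i j)) ∎
  where
  sumFin≡sum₂ : ∀ {m n} (g : Fin m → Fin n → ℕ) → sumFin (λ i → sumFin (g i)) ≡ sum (λ i → sum (g i))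
  sumFin≡sum₂ g = trans (sumFin-cong (sumFin≡sum ∘ g)) (sumFin≡sum (λ i → sum (g i)))

sumFin-permute : ∀ {n} (f : Fin n → ℕ) (π : Permutation n n) → sumFin f ≡ sumFin (f ∘ (π ⟨$⟩ʳ_))
sumFin-permute f π = begin
  sumFin f               ≡⟨ sumFin≡sum f ⟩
  sum f                  ≡⟨ sum-permute f π ⟩
  sum (f ∘ (π ⟨$⟩ʳ_))    ≡⟨ sumFin≡sum (f ∘ (π ⟨$⟩ʳ_)) ⟨
  sumFin (f ∘ (π ⟨$⟩ʳ_)) ∎

sumFin-remove : ∀ {n} (f : Fin (suc n) → ℕ) u → sumFin f ≡ f u + sumFin (f ∘ punchIn u)
sumFin-remove f u = begin
  sumFin f                     ≡⟨ sumFin≡sum f ⟩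
  sum f                        ≡⟨ sum-remove f ⟩
  f u + sum (f ∘ punchIn u)    ≡⟨ cong (f u +_) (sumFin≡sum (f ∘ punchIn u)) ⟨
  f u + sumFin (f ∘ punchIn u) ∎

sumFin-agree-off : ∀ {n} {f g : Fin n → ℕ} u → (∀ i → i ≢ u → f i ≡ g i) → sumFin f + g u ≡ sumFin g + f u
sumFin-agree-off {suc n} {f} {g} u f≗g = begin
  sumFin f + g u                     ≡⟨ cong (_+ g u) (sumFin-remove f u) ⟩
  f u + sumFin (f ∘ punchIn u) + g u
    ≡⟨ cong (λ s → f u + s + g u) (sumFin-cong λ i → f≗g (punchIn u i) (punchInᵢ≢i u i)) ⟩
  f u + sumFin (g ∘ punchIn u) + g u ≡⟨ swap-ends (f u) _ (g u) ⟩
  g u + sumFin (g ∘ punchIn u) + f u ≡⟨ cong (_+ f u) (sumFin-remove g u) ⟨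
  sumFin g + f u                     ∎
  where
  swap-ends : ∀ a s b → a + s + b ≡ b + s + a
  swap-ends a s b = solve (a ∷ s ∷ b ∷ [])

sumFin-single : ∀ {n} {f : Fin n → ℕ} c → (∀ j → j ≢ c → f j ≡ 0) → sumFin f ≡ f c
sumFin-single {n} {f} c zero-off-c = +-cancelʳ-≡ 0 _ _ (begin
  sumFin f + 0               ≡⟨ sumFin-agree-off {g = λ _ → 0} c zero-off-c ⟩
  sumFin {n} (λ _ → 0) + f c ≡⟨ cong (_+ f c) (sumFin-zero n) ⟩
  f c                        ≡⟨ +-identityʳ (f c) ⟨
  f c + 0                    ∎)

b2n-injective : ∀ {a b} → b2n a ≡ b2n b → a ≡ b
b2n-injective {true}  {true}  _ = refl
b2n-injective {false} {false} _ = refl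

countFin-true+false : ∀ {n} (q : Fin n → Bool) → countFin q + countFin (not ∘ q) ≡ n
countFin-true+false {zero}  q = refl
countFin-true+false {suc n} q with q fz | countFin-true+false (q ∘ fs)
... | true  | ih = cong suc ih
... | false | ih = trans (+-suc _ _) (cong suc ih)

∃-true : ∀ {n} (q : Fin n → Bool) → 1 ≤ countFin q → ∃ λ z → q z ≡ true
∃-true {suc n} q 1≤count with q fz in q0
... | true  = fz , q0
... | false = let z , qz = ∃-true (q ∘ fs) 1≤count in fs z , qz

∃-true-avoiding : ∀ {n} (q : Fin n → Bool) → 2 ≤ countFin q → ∀ p → ∃ λ z → q z ≡ true × z ≢ p
∃-true-avoiding {suc n} q 2≤count p = punchIn p z , qz , punchInᵢ≢i p z
  where
  b2n≤1 : ∀ b → b2n b ≤ 1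
  b2n≤1 true  = ≤-refl
  b2n≤1 false = z≤n
  2≤1+rest : 2 ≤ 1 + countFin (q ∘ punchIn p)
  2≤1+rest = ≤-trans (≤-trans 2≤count (≤-reflexive (sumFin-remove (b2n ∘ q) p))) (+-monoˡ-≤ _ (b2n≤1 (q p)))
  found = ∃-true (q ∘ punchIn p) (s≤s⁻¹ 2≤1+rest)
  z = proj₁ found
  qz = proj₂ found

double-injective : ∀ {a b} → a + a ≡ b + b → a ≡ b
double-injective {a} {b} eq = *-cancelˡ-≡ a b 2 (begin
  2 * a ≡⟨ cong (a +_) (+-identityʳ a) ⟩
  a + a ≡⟨ eq ⟩
  b + b ≡⟨ cong (b +_) (+-identityʳ b) ⟨
  2 * b ∎)

exchange-cancel : ∀ {p q a b c d} → p + a + a ≡ q + b + b → p + c + c ≡ q + d + d → a + d ≡ b + c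
exchange-cancel {p} {q} {a} {b} {c} {d} e₁ e₂ = double-injective (+-cancelˡ-≡ (p + q) _ _ (begin
  (p + q) + ((a + d) + (a + d)) ≡⟨ solve (p ∷ q ∷ a ∷ d ∷ []) ⟩
  (p + a + a) + (q + d + d)     ≡⟨ cong₂ _+_ e₁ (sym e₂) ⟩
  (q + b + b) + (p + c + c)     ≡⟨ solve (p ∷ q ∷ b ∷ c ∷ []) ⟩
  (p + q) + ((b + c) + (b + c)) ∎))

parity : ∀ n → (∃ λ k → n ≡ 2 * k) ⊎ (∃ λ k → n ≡ suc (2 * k))
parity zero = inj₁ (0 , refl)
parity (suc n) with parity n
... | inj₁ (k , n≡2k)   = inj₂ (k , cong suc n≡2k)
... | inj₂ (k , n≡2k+1) = inj₁ (suc k , trans (cong suc n≡2k+1) (sym (*-distribˡ-+ 2 1 k)))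

private
  m+1+m : ∀ m → m + suc m ≡ suc (2 * m)
  m+1+m m = trans (+-suc m m) (cong (suc ∘ (m +_)) (sym (+-identityʳ m)))

  m+m : ∀ m → m + m ≡ 2 * m
  m+m m = cong (m +_) (sym (+-identityʳ m))

  successor-of : ∀ {a b} → a < b → b ≤ a + 1 → b ≡ suc a
  successor-of {a} a<b b≤a+1 = ≤-antisym (≤-trans b≤a+1 (≤-reflexive (+-comm a 1))) a<b

near-halves-of-even : ∀ {a b k} → a ≤ b + 1 → b ≤ a + 1 → a + b ≡ 2 * k → a ≡ k × b ≡ k
near-halves-of-even {a} {b} {k} a≤b+1 b≤a+1 a+b≡2k with <-cmp a b
... | tri≈ _ refl _ = let a≡k = *-cancelˡ-≡ a k 2 (trans (sym (m+m a)) a+b≡2k) in a≡k , a≡k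
... | tri< a<b _ _ rewrite successor-of a<b b≤a+1 =
  ⊥-elim (even≢odd k a (sym (trans (sym (m+1+m a)) a+b≡2k)))
... | tri> _ _ b<a rewrite successor-of b<a a≤b+1 =
  ⊥-elim (even≢odd k b (sym (trans (sym (m+1+m b)) (trans (+-comm b (suc b)) a+b≡2k))))

near-halves-of-odd : ∀ {a b k} → a ≤ b + 1 → b ≤ a + 1 → a + b ≡ suc (2 * k) →
  (a ≡ suc k × b ≡ k) ⊎ (a ≡ k × b ≡ suc k)
near-halves-of-odd {a} {b} {k} a≤b+1 b≤a+1 a+b≡2k+1 with <-cmp a b
... | tri≈ _ refl _ = ⊥-elim (even≢odd a k (trans (sym (m+m a)) a+b≡2k+1))
... | tri< a<b _ _ rewrite successor-of a<b b≤a+1 =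
  let a≡k = *-cancelˡ-≡ a k 2 (suc-injective (trans (sym (m+1+m a)) a+b≡2k+1)) in inj₂ (a≡k , cong suc a≡k)
... | tri> _ _ b<a rewrite successor-of b<a a≤b+1 =
  let b≡k = *-cancelˡ-≡ b k 2 (suc-injective (trans (sym (m+1+m b)) (trans (+-comm b (suc b)) a+b≡2k+1)))
  in inj₁ (cong suc b≡k , b≡k)

-- Balanced partitions

-- For a literal b, #on b P reduces to the count of side b used in the definition of Balanced.
#on : ∀ {n} → Bool → Partition n → ℕ
#on b P = countFin (λ i → not b xor P i)

#true #false : ∀ {n} → Partition n → ℕ
#true = #on true
#false = #on false

ConstantOnBalanced : ∀ {n} → (Partition n → ℕ) → Set
ConstantOnBalanced {n} f = ∀ (P Q : Partition n) → Balanced P → Balanced Q → f P ≡ f Q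

balanced-of-counts : ∀ {n} {P : Partition n} {a b} → #true P ≡ a → #false P ≡ b → a ≤ b + 1 → b ≤ a + 1 → Balanced P
balanced-of-counts refl refl a≤b+1 b≤a+1 = a≤b+1 , b≤a+1

balanced-cong : ∀ {n} {P Q : Partition n} → (∀ i → P i ≡ Q i) → Balanced P → Balanced Q
balanced-cong P≗Q = subst₂ (λ t f → t ≤ f + 1 × f ≤ t + 1)
  (sumFin-cong (cong b2n ∘ P≗Q)) (sumFin-cong (cong (b2n ∘ not) ∘ P≗Q))

balanced-even : ∀ {n k} (P : Partition n) → n ≡ 2 * k → Balanced P → #true P ≡ k × #false P ≡ k
balanced-even P n≡2k (t≤f+1 , f≤t+1) = near-halves-of-even t≤f+1 f≤t+1 (trans (countFin-true+false P) n≡2k)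

balanced-odd : ∀ {n k} (P : Partition n) → n ≡ suc (2 * k) → Balanced P →
  (#true P ≡ suc k × #false P ≡ k) ⊎ (#true P ≡ k × #false P ≡ suc k)
balanced-odd P n≡2k+1 (t≤f+1 , f≤t+1) = near-halves-of-odd t≤f+1 f≤t+1 (trans (countFin-true+false P) n≡2k+1)

balanced-counts : ∀ {n} (P Q : Partition n) → Balanced P → Balanced Q →
  (#true P ≡ #true Q × #false P ≡ #false Q) ⊎ (#true P ≡ #false Q × #false P ≡ #true Q)
balanced-counts {n} P Q balP balQ with parity n
... | inj₁ (k , n≡2k) =
  let tP , fP = balanced-even {k = k} P n≡2k balP ; tQ , fQ = balanced-even {k = k} Q n≡2k balQ
  in inj₁ (trans tP (sym tQ) , trans fP (sym fQ))
... | inj₂ (k , n≡2k+1) with balanced-odd {k = k} P n≡2k+1 balP | balanced-odd {k = k} Q n≡2k+1 balQ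
...   | inj₁ (tP , fP) | inj₁ (tQ , fQ) = inj₁ (trans tP (sym tQ) , trans fP (sym fQ))
...   | inj₁ (tP , fP) | inj₂ (tQ , fQ) = inj₂ (trans tP (sym fQ) , trans fP (sym tQ))
...   | inj₂ (tP , fP) | inj₁ (tQ , fQ) = inj₂ (trans tP (sym fQ) , trans fP (sym tQ))
...   | inj₂ (tP , fP) | inj₂ (tQ , fQ) = inj₁ (trans tP (sym tQ) , trans fP (sym fQ))

sumFin-if : ∀ {n} (P : Partition n) a b → sumFin (λ i → if P i then a else b) ≡ #true P * a + #false P * b
sumFin-if {zero}  P a b = refl
sumFin-if {suc n} P a b with P fz | sumFin-if (P ∘ fs) a b
... | true  | ih = trans (cong (a +_) ih) (sym (+-assoc a _ _))
... | false | ih = trans (cong (b +_) ih) (trans (sym (+-assoc b t f)) (trans (cong (_+ f) (+-comm b t)) (+-assoc t b f)))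
  where
  t = #true (P ∘ fs) * a
  f = #false (P ∘ fs) * b

alternating : ∀ {n} → Partition n
alternating {suc n} fz     = false
alternating {suc n} (fs i) = not (alternating i)

alternating-counts : ∀ n →
  #true (alternating {n}) ≤ #false (alternating {n}) × #false (alternating {n}) ≤ #true (alternating {n}) + 1
alternating-counts zero = z≤n , z≤n
alternating-counts (suc n) with alternating-counts n
... | t≤f , f≤t+1 rewrite sumFin-cong (cong b2n ∘ not-involutive ∘ alternating {n}) =
  subst (#false (alternating {n}) ≤_) (+-comm (#true (alternating {n})) 1) f≤t+1 ,
  subst (suc (#true (alternating {n})) ≤_) (+-comm 1 (#false (alternating {n}))) (s≤s t≤f)

alternating-balanced : ∀ n → Balanced (alternating {n})
alternating-balanced n = let t≤f , f≤t+1 = alternating-counts n in ≤-trans t≤f (m≤m+n _ 1) , f≤t+1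

private
  on-side : ∀ b {x} → not b xor x ≡ true → x ≡ b
  on-side true  {true}  _ = refl
  on-side false {false} _ = refl

pick : ∀ {n} (P : Partition n) b → 1 ≤ #on b P → ∃ λ z → P z ≡ b
pick P b 1≤#b = let z , on-b = ∃-true _ 1≤#b in z , on-side b on-b

pick-avoiding : ∀ {n} (P : Partition n) b → 2 ≤ #on b P → ∀ p → ∃ λ z → P z ≡ b × z ≢ p
pick-avoiding P b 2≤#b p = let z , on-b , z≢p = ∃-true-avoiding _ 2≤#b p in z , on-side b on-b , z≢p

on-opposite-sides : ∀ {n} {P : Partition n} {i j b} → P i ≡ b → P j ≡ not b → i ≢ j
on-opposite-sides {b = true}  Pi Pj refl = case trans (sym Pi) Pj of λ ()
on-opposite-sides {b = false} Pi Pj refl = case trans (sym Pi) Pj of λ ()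

_[_↔_] : ∀ {n} → Partition n → Fin n → Fin n → Partition n
P [ y ↔ z ] = P ∘ (transpose y z ⟨$⟩ʳ_)

_[_]≔_ : ∀ {n} → Partition n → Fin n → Bool → Partition n
P [ y ]≔ b = updateAt P y (const b)

module _ {n} (P : Partition n) (y z : Fin n) where

  ↔-left : (P [ y ↔ z ]) y ≡ P z
  ↔-left rewrite dec-true (y ≟ y) refl = refl

  ↔-right : (P [ y ↔ z ]) z ≡ P y
  ↔-right with z ≟ y
  ... | yes refl = refl
  ... | no z≢y rewrite dec-true (z ≟ z) refl = refl

  ↔-other : ∀ {i} → i ≢ y → i ≢ z → (P [ y ↔ z ]) i ≡ P i
  ↔-other {i} i≢y i≢z rewrite dec-false (i ≟ y) i≢y | dec-false (i ≟ z) i≢z = refl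

  ↔-agree-off : ∀ i → i ≢ z → (P [ y ↔ z ]) i ≡ (P [ y ]≔ P z) i
  ↔-agree-off i i≢z = by-cases (i ≟ y)
    where
    by-cases : Dec (i ≡ y) → (P [ y ↔ z ]) i ≡ (P [ y ]≔ P z) i
    by-cases (yes refl) = trans ↔-left (sym (updateAt-updates i P))
    by-cases (no i≢y)   = trans (↔-other i≢y i≢z) (sym (updateAt-minimal i y P i≢y))

  #on-↔ : ∀ b → #on b (P [ y ↔ z ]) ≡ #on b P
  #on-↔ b = sym (sumFin-permute (λ i → b2n (not b xor P i)) (transpose y z))

  balanced-↔ : Balanced P → Balanced (P [ y ↔ z ])
  balanced-↔ = subst₂ (λ t f → t ≤ f + 1 × f ≤ t + 1) (sym (#on-↔ true)) (sym (#on-↔ false))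

↔-keeps-other-side : ∀ {n} {P : Partition n} {y z i b} → P z ≡ b → i ≢ y → P i ≡ not b → (P [ y ↔ z ]) i ≡ P i
↔-keeps-other-side {P = P} {y} {z} Pz i≢y Pi = ↔-other P y z i≢y (λ i≡z → on-opposite-sides Pz Pi (sym i≡z))

#on-≔ : ∀ {n} (P : Partition n) y b c → #on c (P [ y ]≔ b) + b2n (not c xor P y) ≡ #on c P + b2n (not c xor b)
#on-≔ P y b c rewrite sym (cong (λ a → b2n (not c xor a)) (updateAt-updates y {f = const b} P)) =
  sumFin-agree-off y (λ i i≢y → cong (λ a → b2n (not c xor a)) (updateAt-minimal i y P i≢y))

#on-raise : ∀ {n} (R : Partition n) w → R w ≡ false →
  #true (R [ w ]≔ true) ≡ suc (#true R) × suc (#false (R [ w ]≔ true)) ≡ #false R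
#on-raise R w Rw with #on-≔ R w true true | #on-≔ R w true false
... | t | f rewrite Rw = trans (sym (+-identityʳ _)) (trans t (+-comm _ 1)) , trans (+-comm 1 _) (trans f (+-identityʳ _))

-- Negative edges and moves of single vertices

ordered-pair-split : ∀ {n} (i j : Fin n) (q : Bool) → (i ≡ j → q ≡ false) →
  b2n ((toℕ i <ᵇ toℕ j) ∧ q) + b2n ((toℕ j <ᵇ toℕ i) ∧ q) ≡ b2n q
ordered-pair-split i j q diagonal
  with toℕ i <ᵇ toℕ j | <ᵇ-reflects-< (toℕ i) (toℕ j) | toℕ j <ᵇ toℕ i | <ᵇ-reflects-< (toℕ j) (toℕ i)
... | true  | ofʸ i<j | true  | ofʸ j<i = ⊥-elim (<-asym i<j j<i)
... | true  | _       | false | _       = +-identityʳ (b2n q)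
... | false | _       | true  | _       = refl
... | false | ofⁿ i≮j | false | ofⁿ j≮i rewrite diagonal (toℕ-injective (≤-antisym (≮⇒≥ j≮i) (≮⇒≥ i≮j))) = refl

countPairs-double : ∀ {n} (p : Fin n → Fin n → Bool) → (∀ i j → p i j ≡ p j i) → (∀ i → p i i ≡ false) →
  countPairs p + countPairs p ≡ sumFin (λ i → countFin (p i))
countPairs-double p p-sym p-irrefl = begin
  countPairs p + countPairs p
    ≡⟨ cong (countPairs p +_) (sumFin-comm before) ⟩
  countPairs p + sumFin (λ i → sumFin (λ j → before j i))
    ≡⟨ cong (countPairs p +_) (sumFin-cong λ i → sumFin-cong λ j → cong (λ b → b2n ((toℕ j <ᵇ toℕ i) ∧ b)) (p-sym j i)) ⟩
  countPairs p + sumFin (λ i → sumFin (after i))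
    ≡⟨ sumFin-distrib-+ (λ i → sumFin (before i)) (λ i → sumFin (after i)) ⟨
  sumFin (λ i → sumFin (before i) + sumFin (after i))
    ≡⟨ sumFin-cong (λ i → sumFin-distrib-+ (before i) (after i)) ⟨
  sumFin (λ i → sumFin (λ j → before i j + after i j))
    ≡⟨ sumFin-cong (λ i → sumFin-cong λ j → ordered-pair-split i j (p i j) λ { refl → p-irrefl i }) ⟩
  sumFin (λ i → countFin (p i)) ∎
  where
  before after : _ → _ → ℕ
  before i j = b2n ((toℕ i <ᵇ toℕ j) ∧ p i j)
  after i j = b2n ((toℕ j <ᵇ toℕ i) ∧ p i j)

crossDegree : ∀ {n} → Graph n → Partition n → Fin n → Bool → ℕ
crossDegree G P u b = countFin (λ j → adj G u j ∧ (b xor P j))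

negEdgeEnds : ∀ {n} → Graph n → Partition n → ℕ
negEdgeEnds G P = sumFin (λ u → crossDegree G P u (P u))

negEdges-double : ∀ {n} (G : Graph n) P → negEdges G P + negEdges G P ≡ negEdgeEnds G P
negEdges-double G P = countPairs-double _
  (λ i j → cong₂ _∧_ (adj-sym G i j) (xor-comm (P i) (P j)))
  (λ i → cong (_∧ (P i xor P i)) (adj-irrefl G i))

module _ {n} (G : Graph n) where

  edge : Fin n → Fin n → ℕ
  edge u v = b2n (adj G u v)

  crossDegree-agree-off : ∀ {P Q : Partition n} w t c → (∀ i → i ≢ w → Q i ≡ P i) →
    crossDegree G Q t c + b2n (adj G t w ∧ (c xor P w)) ≡ crossDegree G P t c + b2n (adj G t w ∧ (c xor Q w))
  crossDegree-agree-off w t c Q≗P = sumFin-agree-off w λ i i≢w → cong (λ b → b2n (adj G t i ∧ (c xor b))) (Q≗P i i≢w)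

  crossDegree-by-columns : ∀ (P : Partition n) u c → sumFin (λ i → b2n (adj G i u ∧ (P i xor c))) ≡ crossDegree G P u c
  crossDegree-by-columns P u c = sumFin-cong λ i → cong b2n (cong₂ _∧_ (adj-sym G i u) (xor-comm (P i) c))

  negEdgeEnds-agree-off : ∀ {P Q : Partition n} u → (∀ i → i ≢ u → Q i ≡ P i) →
    negEdgeEnds G Q + crossDegree G P u (P u) + crossDegree G P u (P u)
      ≡ negEdgeEnds G P + crossDegree G P u (Q u) + crossDegree G P u (Q u)
  negEdgeEnds-agree-off {P} {Q} u Q≗P = begin
    negEdgeEnds G Q + X + X
      ≡⟨ cong₂ _+_ (trans (sumFin-distrib-+ (row Q) x) (cong (negEdgeEnds G Q +_) (crossDegree-by-columns P u (P u))))
                   (trans (cong (X +_) (no-loop (Q u))) (+-identityʳ X)) ⟨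
    sumFin (λ i → row Q i + x i) + (row P u + y u)
      ≡⟨ sumFin-agree-off u rows-off-u ⟩
    sumFin (λ i → row P i + y i) + (row Q u + x u)
      ≡⟨ cong₂ _+_ (trans (sumFin-distrib-+ (row P) y) (cong (negEdgeEnds G P +_) (crossDegree-by-columns P u (Q u))))
                   (trans (cong₂ _+_ row-u (no-loop (P u))) (+-identityʳ Y)) ⟩
    negEdgeEnds G P + Y + Y ∎
    where
    X = crossDegree G P u (P u)
    Y = crossDegree G P u (Q u)
    row : Partition n → Fin n → ℕ
    row R i = crossDegree G R i (R i)
    column : Bool → Fin n → ℕ
    column c i = b2n (adj G i u ∧ (P i xor c))
    x y : Fin n → ℕ
    x = column (P u)
    y = column (Q u)
    no-loop : ∀ c → column c u ≡ 0
    no-loop c = cong (λ a → b2n (a ∧ (P u xor c))) (adj-irrefl G u)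
    rows-off-u : ∀ i → i ≢ u → row Q i + x i ≡ row P i + y i
    rows-off-u i i≢u rewrite Q≗P i i≢u = crossDegree-agree-off u i (P i) Q≗P
    row-u : row Q u ≡ Y
    row-u = +-cancelʳ-≡ 0 _ _ (begin
      row Q u + 0                               ≡⟨ cong (λ a → row Q u + b2n (a ∧ (Q u xor P u))) (adj-irrefl G u) ⟨
      row Q u + b2n (adj G u u ∧ (Q u xor P u)) ≡⟨ crossDegree-agree-off u u (Q u) Q≗P ⟩
      Y + b2n (adj G u u ∧ (Q u xor Q u))       ≡⟨ cong (λ a → Y + b2n (a ∧ (Q u xor Q u))) (adj-irrefl G u) ⟩
      Y + 0                                     ∎)

  crossDegree-raise : ∀ {R P : Partition n} w t → (∀ i → i ≢ w → P i ≡ R i) → R w ≡ false → P w ≡ true →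
    (crossDegree G P t false ≡ crossDegree G R t false + edge t w) × (crossDegree G P t true + edge t w ≡ crossDegree G R t true)
  crossDegree-raise w t P≗R Rw Pw with crossDegree-agree-off w t false P≗R | crossDegree-agree-off w t true P≗R
  ... | into-true | into-false rewrite Rw | Pw | ∧-zeroʳ (adj G t w) | ∧-identityʳ (adj G t w) =
    trans (sym (+-identityʳ _)) into-true , trans into-false (+-identityʳ _)

  -- With u on side true and v on side false: the edges from u and v into their own sides, resp. into the other sides.
  sameSide crossSide : Partition n → Fin n → Fin n → ℕ
  sameSide P u v = crossDegree G P u false + crossDegree G P v true
  crossSide P u v = crossDegree G P u true + crossDegree G P v false

  -- The exchange is split into moving u to side false and then v to side true.
  swap-balance : ∀ (P : Partition n) {u v} → P u ≡ true → P v ≡ false →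
    negEdgeEnds G (P [ u ↔ v ]) ≡ negEdgeEnds G P →
    sameSide P u v + edge u v + edge u v ≡ crossSide P u v
  swap-balance P {u} {v} Pu Pv swap-invariant = begin
    UT + VF + e + e   ≡⟨ cong (_+ e) (+-assoc UT VF e) ⟩
    UT + (VF + e) + e ≡⟨ cong (λ t → UT + t + e) VF+e≡Y₁ ⟩
    UT + Y₁ + e       ≡⟨ cong (_+ e) (exchange-cancel {a = UF} {UT} {Y₁} {X₁} move-u (sym move-v)) ⟨
    UF + X₁ + e       ≡⟨ +-assoc UF X₁ e ⟩
    UF + (X₁ + e)     ≡⟨ cong (UF +_) VT≡X₁+e ⟨
    UF + VT           ∎
    where
    UT = crossDegree G P u false
    UF = crossDegree G P u true
    VT = crossDegree G P v false
    VF = crossDegree G P v true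
    e = edge u v
    P₁ = P [ u ]≔ P v
    P₁≗P : ∀ i → i ≢ u → P₁ i ≡ P i
    P₁≗P i i≢u = updateAt-minimal i u P i≢u
    P₁u : P₁ u ≡ false
    P₁u = trans (updateAt-updates u P) Pv
    P₁v : P₁ v ≡ false
    P₁v = trans (P₁≗P v (λ { refl → case trans (sym Pu) Pv of λ () })) Pv
    X₁ = crossDegree G P₁ v false
    Y₁ = crossDegree G P₁ v true
    move-u : negEdgeEnds G P₁ + UF + UF ≡ negEdgeEnds G P + UT + UT
    move-u with negEdgeEnds-agree-off u P₁≗P
    ... | moved rewrite Pu | P₁u = moved
    move-v : negEdgeEnds G P + X₁ + X₁ ≡ negEdgeEnds G P₁ + Y₁ + Y₁
    move-v with negEdgeEnds-agree-off v (↔-agree-off P u v)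
    ... | moved rewrite swap-invariant | P₁v | ↔-right P u v | Pu = moved
    raise = crossDegree-raise {R = P₁} u v (λ i i≢u → sym (P₁≗P i i≢u)) P₁u Pu
    e≡e′ : edge v u ≡ e
    e≡e′ = cong b2n (adj-sym G v u)
    VT≡X₁+e : VT ≡ X₁ + e
    VT≡X₁+e = trans (proj₁ raise) (cong (X₁ +_) e≡e′)
    VF+e≡Y₁ : VF + e ≡ Y₁
    VF+e≡Y₁ = trans (cong (VF +_) (sym e≡e′)) (proj₂ raise)

  raise-balance : ∀ {R P : Partition n} {u v w} → u ≢ w → v ≢ w → (∀ i → i ≢ w → P i ≡ R i) →
    R u ≡ true → R v ≡ false → R w ≡ false → P w ≡ true →
    negEdgeEnds G (P [ u ↔ v ]) ≡ negEdgeEnds G P →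
    sameSide R u v + edge u v + edge u v + edge u w + edge u w ≡ crossSide R u v + edge v w + edge v w
  raise-balance {R} {P} {u} {v} {w} u≢w v≢w P≗R Ru Rv Rw Pw swap-invariant =
    rearrange (proj₁ raise-u) (proj₂ raise-u) (proj₁ raise-v) (proj₂ raise-v)
      (swap-balance P (trans (P≗R u u≢w) Ru) (trans (P≗R v v≢w) Rv) swap-invariant)
    where
    raise-u = crossDegree-raise w u P≗R Rw Pw
    raise-v = crossDegree-raise w v P≗R Rw Pw
    rearrange : ∀ {UTP UTR UFP UFR VTP VTR VFP VFR e a b} →
      UTP ≡ UTR + a → UFP + a ≡ UFR → VTP ≡ VTR + b → VFP + b ≡ VFR →
      UTP + VFP + e + e ≡ UFP + VTP → UTR + VFR + e + e + a + a ≡ UFR + VTR + b + b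
    rearrange {UTR = UTR} {UFP = UFP} {VTR = VTR} {VFP = VFP} {e = e} {a = a} {b = b} refl refl refl refl balance = begin
      UTR + (VFP + b) + e + e + a + a ≡⟨ solve (UTR ∷ VFP ∷ e ∷ a ∷ b ∷ []) ⟩
      UTR + a + VFP + e + e + (a + b) ≡⟨ cong (_+ (a + b)) balance ⟩
      UFP + (VTR + b) + (a + b)       ≡⟨ solve (UFP ∷ VTR ∷ a ∷ b ∷ []) ⟩
      UFP + a + VTR + b + b           ∎

  module _ (constant : ConstantOnBalanced (negEdgeEnds G)) where

    private
      raise-balance-of-constant : ∀ {R : Partition n} {u v w} → u ≢ w → v ≢ w →
        R u ≡ true → R v ≡ false → R w ≡ false → Balanced (R [ w ]≔ true) →
        sameSide R u v + edge u v + edge u v + edge u w + edge u w ≡ crossSide R u v + edge v w + edge v w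
      raise-balance-of-constant {R} {u} {v} {w} u≢w v≢w Ru Rv Rw bal⁺ =
        raise-balance u≢w v≢w (λ i i≢w → updateAt-minimal i w R i≢w) Ru Rv Rw (updateAt-updates w R)
          (constant _ _ (balanced-↔ (R [ w ]≔ true) u v bal⁺) bal⁺)

    edges-agree : ∀ {R : Partition n} {u v w} → u ≢ w → v ≢ w → R u ≡ true → R v ≡ false → R w ≡ false →
      Balanced R → Balanced (R [ w ]≔ true) → edge u w ≡ edge v w
    edges-agree {R} {u} {v} {w} u≢w v≢w Ru Rv Rw bal bal⁺ = +-cancelʳ-≡ 0 _ _
      (exchange-cancel {a = edge u w} {edge v w} {0} {0} (raise-balance-of-constant u≢w v≢w Ru Rv Rw bal⁺)
        (cong (λ t → t + 0 + 0) (swap-balance R Ru Rv (constant _ _ (balanced-↔ R u v bal) bal))))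

    edges-exchange : ∀ {R : Partition n} {u v w x} → u ≢ w → v ≢ w → u ≢ x → v ≢ x →
      R u ≡ true → R v ≡ false → R w ≡ false → R x ≡ false → Balanced (R [ w ]≔ true) → Balanced (R [ x ]≔ true) →
      edge u w + edge v x ≡ edge v w + edge u x
    edges-exchange {u = u} {v} {w} {x} u≢w v≢w u≢x v≢x Ru Rv Rw Rx bal-w bal-x =
      exchange-cancel {a = edge u w} {edge v w} {edge u x} {edge v x}
        (raise-balance-of-constant u≢w v≢w Ru Rv Rw bal-w) (raise-balance-of-constant u≢x v≢x Ru Rv Rx bal-x)

-- Balanced partitions separating given vertices

two-distinct⇒1≤k : ∀ {n k} → n ≡ suc (2 * k) → {u v : Fin n} → u ≢ v → 1 ≤ k
two-distinct⇒1≤k {k = suc k} _ _ = s≤s z≤n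
two-distinct⇒1≤k {k = zero} refl {fz} {fz} u≢v = ⊥-elim (u≢v refl)

three-distinct⇒2≤k : ∀ {n k} → n ≡ 2 * k → {u v w : Fin n} → u ≢ v → u ≢ w → v ≢ w → 2 ≤ k
three-distinct⇒2≤k {k = suc (suc k)} _ _ _ _ = s≤s (s≤s z≤n)
three-distinct⇒2≤k {k = zero}     refl {()}
three-distinct⇒2≤k {k = suc zero} refl {fz}    {fz}            u≢v _   _   = ⊥-elim (u≢v refl)
three-distinct⇒2≤k {k = suc zero} refl {fs fz} {fs fz}         u≢v _   _   = ⊥-elim (u≢v refl)
three-distinct⇒2≤k {k = suc zero} refl {fz}    {fs fz} {fz}    _   u≢w _   = ⊥-elim (u≢w refl)
three-distinct⇒2≤k {k = suc zero} refl {fz}    {fs fz} {fs fz} _   _   v≢w = ⊥-elim (v≢w refl)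
three-distinct⇒2≤k {k = suc zero} refl {fs fz} {fz}    {fz}    _   _   v≢w = ⊥-elim (v≢w refl)
three-distinct⇒2≤k {k = suc zero} refl {fs fz} {fz}    {fs fz} _   u≢w _   = ⊥-elim (u≢w refl)

alternating-counts-odd : ∀ {n k} → n ≡ suc (2 * k) → #true (alternating {n}) ≡ k × #false (alternating {n}) ≡ suc k
alternating-counts-odd {n} n≡2k+1 with balanced-odd alternating n≡2k+1 (alternating-balanced n) | alternating-counts n
... | inj₁ (t≡k+1 , f≡k) | t≤f , _ = ⊥-elim (<-irrefl refl (subst₂ _≤_ t≡k+1 f≡k t≤f))
... | inj₂ counts        | _       = counts

odd-witness : ∀ {n k} → n ≡ suc (2 * k) → 1 ≤ k → ∀ {u v w : Fin n} → u ≢ v → u ≢ w → v ≢ w →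
  ∃ λ R → Balanced R × Balanced (R [ w ]≔ true) × R u ≡ true × R v ≡ false × R w ≡ false
odd-witness {n} {k} n≡2k+1 1≤k {u} {v} {w} u≢v u≢w v≢w = P₃ , bal₃ , bal⁺ , P₃u , P₃v , P₃w
  where
  P₀ = alternating {n}
  counts₀ = alternating-counts-odd {k = k} n≡2k+1
  picked₁ = pick P₀ true (subst (1 ≤_) (sym (proj₁ counts₀)) 1≤k)
  z₁ = proj₁ picked₁
  P₁ = P₀ [ u ↔ z₁ ]
  P₁u : P₁ u ≡ true
  P₁u = trans (↔-left P₀ u z₁) (proj₂ picked₁)
  #false₁ : #false P₁ ≡ suc k
  #false₁ = trans (#on-↔ P₀ u z₁ false) (proj₂ counts₀)
  picked₂ = pick P₁ false (subst (1 ≤_) (sym #false₁) (s≤s z≤n))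
  z₂ = proj₁ picked₂
  P₂ = P₁ [ v ↔ z₂ ]
  P₂u : P₂ u ≡ true
  P₂u = trans (↔-keeps-other-side {P = P₁} (proj₂ picked₂) u≢v P₁u) P₁u
  P₂v : P₂ v ≡ false
  P₂v = trans (↔-left P₁ v z₂) (proj₂ picked₂)
  #false₂ : #false P₂ ≡ suc k
  #false₂ = trans (#on-↔ P₁ v z₂ false) #false₁
  picked₃ = pick-avoiding P₂ false (subst (2 ≤_) (sym #false₂) (s≤s 1≤k)) v
  z₃ = proj₁ picked₃
  P₂z₃ : P₂ z₃ ≡ false
  P₂z₃ = proj₁ (proj₂ picked₃)
  P₃ = P₂ [ w ↔ z₃ ]
  P₃u : P₃ u ≡ true
  P₃u = trans (↔-keeps-other-side {P = P₂} P₂z₃ u≢w P₂u) P₂u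
  P₃v : P₃ v ≡ false
  P₃v = trans (↔-other P₂ w z₃ v≢w (proj₂ (proj₂ picked₃) ∘ sym)) P₂v
  P₃w : P₃ w ≡ false
  P₃w = trans (↔-left P₂ w z₃) P₂z₃
  bal₃ : Balanced P₃
  bal₃ = balanced-↔ P₂ w z₃ (balanced-↔ P₁ v z₂ (balanced-↔ P₀ u z₁ (alternating-balanced n)))
  #true₃ : #true P₃ ≡ k
  #true₃ = trans (#on-↔ P₂ w z₃ true) (trans (#on-↔ P₁ v z₂ true) (trans (#on-↔ P₀ u z₁ true) (proj₁ counts₀)))
  raised = #on-raise P₃ w P₃w
  bal⁺ : Balanced (P₃ [ w ]≔ true)
  bal⁺ = balanced-of-counts {P = P₃ [ w ]≔ true}
    (trans (proj₁ raised) (cong suc #true₃)) (suc-injective (trans (proj₂ raised) (trans (#on-↔ P₂ w z₃ false) #false₂)))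
    (≤-reflexive (+-comm 1 k)) (≤-trans (n≤1+n k) (m≤m+n (suc k) 1))

separating-partition : ∀ {n k} → n ≡ 2 * k → 2 ≤ k →
  ∀ {u v w x : Fin n} → u ≢ v → u ≢ w → u ≢ x → v ≢ w → v ≢ x → w ≢ x →
  ∃ λ P → Balanced P × P u ≡ true × P v ≡ false × P w ≡ true × P x ≡ false
separating-partition {n} {k} n≡2k 2≤k {u} {v} {w} {x} u≢v u≢w u≢x v≢w v≢x w≢x =
  P₄ , bal₄ , P₄u , P₄v , P₄w , P₄x
  where
  at-least : ∀ {P : Partition n} m b → m ≤ k → Balanced P → m ≤ #on b P
  at-least m true  m≤k bal = subst (m ≤_) (sym (proj₁ (balanced-even _ n≡2k bal))) m≤k
  at-least m false m≤k bal = subst (m ≤_) (sym (proj₂ (balanced-even _ n≡2k bal))) m≤k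
  1≤k = ≤-trans (s≤s z≤n) 2≤k
  P₀ = alternating {n}
  bal₀ = alternating-balanced n
  picked₁ = pick P₀ true (at-least 1 true 1≤k bal₀)
  z₁ = proj₁ picked₁
  P₁ = P₀ [ u ↔ z₁ ]
  bal₁ = balanced-↔ P₀ u z₁ bal₀
  P₁u : P₁ u ≡ true
  P₁u = trans (↔-left P₀ u z₁) (proj₂ picked₁)
  picked₂ = pick P₁ false (at-least 1 false 1≤k bal₁)
  z₂ = proj₁ picked₂
  P₂ = P₁ [ v ↔ z₂ ]
  bal₂ = balanced-↔ P₁ v z₂ bal₁
  P₂u : P₂ u ≡ true
  P₂u = trans (↔-keeps-other-side {P = P₁} (proj₂ picked₂) u≢v P₁u) P₁u
  P₂v : P₂ v ≡ false
  P₂v = trans (↔-left P₁ v z₂) (proj₂ picked₂)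
  picked₃ = pick-avoiding P₂ true (at-least 2 true 2≤k bal₂) u
  z₃ = proj₁ picked₃
  P₂z₃ : P₂ z₃ ≡ true
  P₂z₃ = proj₁ (proj₂ picked₃)
  P₃ = P₂ [ w ↔ z₃ ]
  bal₃ = balanced-↔ P₂ w z₃ bal₂
  P₃u : P₃ u ≡ true
  P₃u = trans (↔-other P₂ w z₃ u≢w (proj₂ (proj₂ picked₃) ∘ sym)) P₂u
  P₃v : P₃ v ≡ false
  P₃v = trans (↔-keeps-other-side {P = P₂} P₂z₃ v≢w P₂v) P₂v
  P₃w : P₃ w ≡ true
  P₃w = trans (↔-left P₂ w z₃) P₂z₃
  picked₄ = pick-avoiding P₃ false (at-least 2 false 2≤k bal₃) v
  z₄ = proj₁ picked₄
  P₃z₄ : P₃ z₄ ≡ false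
  P₃z₄ = proj₁ (proj₂ picked₄)
  P₄ = P₃ [ x ↔ z₄ ]
  bal₄ = balanced-↔ P₃ x z₄ bal₃
  P₄u : P₄ u ≡ true
  P₄u = trans (↔-keeps-other-side {P = P₃} P₃z₄ u≢x P₃u) P₃u
  P₄v : P₄ v ≡ false
  P₄v = trans (↔-other P₃ x z₄ v≢x (proj₂ (proj₂ picked₄) ∘ sym)) P₃v
  P₄w : P₄ w ≡ true
  P₄w = trans (↔-keeps-other-side {P = P₃} P₃z₄ w≢x P₃w) P₃w
  P₄x : P₄ x ≡ false
  P₄x = trans (↔-left P₃ x z₄) P₃z₄

-- R is P with w moved to side false; raising w gives back P, raising x gives P with w and x exchanged.
lowered-witness : ∀ {n} (P : Partition n) {u v w x} → u ≢ w → v ≢ w → w ≢ x →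
  Balanced P → P u ≡ true → P v ≡ false → P w ≡ true → P x ≡ false →
  ∃ λ R → Balanced (R [ w ]≔ true) × Balanced (R [ x ]≔ true) × R u ≡ true × R v ≡ false × R w ≡ false × R x ≡ false
lowered-witness P {u} {v} {w} {x} u≢w v≢w w≢x bal Pu Pv Pw Px =
  R , balanced-cong (sym ∘ raise-w) bal , balanced-cong (sym ∘ raise-x) (balanced-↔ P w x bal) ,
  trans (R≗P u u≢w) Pu , trans (R≗P v v≢w) Pv , updateAt-updates w P , trans (R≗P x (w≢x ∘ sym)) Px
  where
  R = P [ w ]≔ false
  R≗P : ∀ i → i ≢ w → R i ≡ P i
  R≗P i i≢w = updateAt-minimal i w P i≢w
  raise-w : ∀ i → (R [ w ]≔ true) i ≡ P i
  raise-w i = by-cases (i ≟ w)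
    where
    by-cases : Dec (i ≡ w) → (R [ w ]≔ true) i ≡ P i
    by-cases (yes refl) = trans (updateAt-updates w R) (sym Pw)
    by-cases (no i≢w)   = trans (updateAt-minimal i w R i≢w) (R≗P i i≢w)
  raise-x : ∀ i → (R [ x ]≔ true) i ≡ (P [ w ↔ x ]) i
  raise-x i = by-cases (i ≟ x) (i ≟ w)
    where
    by-cases : Dec (i ≡ x) → Dec (i ≡ w) → (R [ x ]≔ true) i ≡ (P [ w ↔ x ]) i
    by-cases (yes refl) _          = trans (updateAt-updates x R) (sym (trans (↔-right P w x) Pw))
    by-cases (no i≢x)   (yes refl) = trans (updateAt-minimal i x R i≢x) (trans (updateAt-updates i P) (sym (trans (↔-left P i x) Px)))
    by-cases (no i≢x)   (no i≢w)   = trans (updateAt-minimal i x R i≢x) (trans (R≗P i i≢w) (sym (↔-other P w x i≢w i≢x)))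

-- Complete graphs and stars

IsComplete : ∀ {n} → Graph n → Set
IsComplete {n} G = ∀ (x y : Fin n) → x ≢ y → adj G x y ≡ true

IsStarAt : ∀ {n} → Graph n → Fin n → Set
IsStarAt {n} G c = (∀ j → j ≢ c → adj G c j ≡ true) × (∀ i j → i ≢ c → j ≢ c → adj G i j ≡ false)

starAdj : ∀ {n} → Fin n → Fin n → Fin n → Bool
starAdj c i j = not (does (i ≟ j)) ∧ (does (i ≟ c) ∨ does (j ≟ c))

module _ {n} (f : Fin n ↔ Fin n) where
  open Inverse f

  does-≟-to : ∀ a b → does (to a ≟ to b) ≡ does (a ≟ b)
  does-≟-to a b = does-⇔ (mk⇔ injective (cong to)) (to a ≟ to b) (a ≟ b)
    where
    injective : ∀ {a b} → to a ≡ to b → a ≡ b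
    injective {a} {b} eq = trans (sym (strictlyInverseʳ a)) (trans (cong from eq) (strictlyInverseʳ b))

  does-≟-from : ∀ a c → does (to a ≟ c) ≡ does (a ≟ from c)
  does-≟-from a c = does-⇔ (mk⇔ (λ eq → trans (sym (strictlyInverseʳ a)) (cong from eq))
                                (λ eq → trans (cong to eq) (strictlyInverseˡ c)))
                           (to a ≟ c) (a ≟ from c)

star-adj-to : ∀ {m} (f : Fin (suc m) ↔ Fin (suc m)) a b →
  adj (star (suc m)) (Inverse.to f a) (Inverse.to f b) ≡ starAdj (Inverse.from f fz) a b
star-adj-to f a b = cong₂ _∧_ (cong not (does-≟-to f a b)) (cong₂ _∨_ (centre a) (centre b))
  where
  isCentre-zero : ∀ {m} (y : Fin (suc m)) → isCentre y ≡ does (y ≟ fz)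
  isCentre-zero fz     = refl
  isCentre-zero (fs y) = refl
  centre : ∀ a → isCentre (Inverse.to f a) ≡ does (a ≟ Inverse.from f fz)
  centre a = trans (isCentre-zero (Inverse.to f a)) (does-≟-from f a fz)

≅complete⇒complete : ∀ {n} (G : Graph n) → G ≅ complete n → IsComplete G
≅complete⇒complete G (f , adj≡) x y x≢y =
  trans (adj≡ x y) (trans (cong not (does-≟-to f x y)) (cong not (dec-false (x ≟ y) x≢y)))

complete⇒≅complete : ∀ {n} (G : Graph n) → IsComplete G → G ≅ complete n
complete⇒≅complete {n} G complete = ↔-id (Fin n) , adj≡
  where
  adj≡ : ∀ x y → adj G x y ≡ not (does (x ≟ y))
  adj≡ x y with x ≟ y
  ... | yes refl = adj-irrefl G x
  ... | no x≢y   = complete x y x≢y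

≅star⇒star : ∀ {m} (G : Graph (suc m)) → G ≅ star (suc m) → ∃ (IsStarAt G)
≅star⇒star G (f , adj≡) = c , leaves , no-other-edges
  where
  c = Inverse.from f fz
  leaves : ∀ j → j ≢ c → adj G c j ≡ true
  leaves j j≢c rewrite adj≡ c j | star-adj-to f c j | dec-false (c ≟ j) (j≢c ∘ sym) | dec-true (c ≟ c) refl = refl
  no-other-edges : ∀ i j → i ≢ c → j ≢ c → adj G i j ≡ false
  no-other-edges i j i≢c j≢c rewrite adj≡ i j | star-adj-to f i j | dec-false (i ≟ c) i≢c | dec-false (j ≟ c) j≢c =
    ∧-zeroʳ (not (does (i ≟ j)))

star⇒≅star : ∀ {n} (G : Graph n) {c} → IsStarAt G c → G ≅ star n
star⇒≅star {suc m} G {c} (leaves , no-other-edges) = f , λ a b → trans (adj≡ a b) (sym (star-adj-to f a b))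
  where
  f = transpose c fz
  adj≡ : ∀ a b → adj G a b ≡ starAdj c a b
  adj≡ a b with a ≟ c | b ≟ c
  ... | yes refl | yes refl rewrite dec-true (a ≟ a) refl = adj-irrefl G a
  ... | yes refl | no b≢c   rewrite dec-false (a ≟ b) (b≢c ∘ sym) = leaves b b≢c
  ... | no a≢c   | yes refl rewrite dec-false (a ≟ b) a≢c = trans (adj-sym G a b) (leaves a a≢c)
  ... | no a≢c   | no b≢c   rewrite ∧-zeroʳ (not (does (a ≟ b))) = no-other-edges a b a≢c b≢c

missing-edge? : ∀ {n} (G : Graph n) → IsComplete G ⊎ ∃ λ x → ∃ λ y → x ≢ y × adj G x y ≡ false
missing-edge? G with any? (λ x → any? (λ y → ¬? (x ≟ y) ×-dec (adj G x y Bool.≟ false)))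
... | yes (x , y , x≢y , xy) = inj₂ (x , y , x≢y , xy)
... | no no-missing-edge     = inj₁ λ x y x≢y → ¬-not λ xy → no-missing-edge (x , y , x≢y , xy)

EdgesAgree EdgesExchange : ∀ {n} → Graph n → Set
EdgesAgree {n} G = ∀ {u v w : Fin n} → u ≢ v → u ≢ w → v ≢ w → edge G u w ≡ edge G v w
EdgesExchange {n} G = ∀ {u v w x : Fin n} → u ≢ v → u ≢ w → u ≢ x → v ≢ w → v ≢ x → w ≢ x →
  edge G u w + edge G v x ≡ edge G v w + edge G u x

module _ {n} (G : Graph n) (connected : Connected G) where

  neighbour : ∀ {x y} → x ≢ y → ∃ λ z → adj G x z ≡ true
  neighbour {x} {y} x≢y = first-step (connected x y) x≢y
    where
    first-step : ∀ {x y} → Walk G x y → x ≢ y → ∃ λ z → adj G x z ≡ true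
    first-step here          x≢x = ⊥-elim (x≢x refl)
    first-step (step xz _) _ = _ , xz

  adjacent⇒≢ : ∀ {x z} → adj G x z ≡ true → x ≢ z
  adjacent⇒≢ {x} xz refl = case trans (sym xz) (adj-irrefl G x) of λ ()

  complete-if-edges-agree : EdgesAgree G → IsComplete G
  complete-if-edges-agree agree x y x≢y with neighbour x≢y
  ... | z , xz with z ≟ y
  ...   | yes refl = xz
  ...   | no z≢y   = trans (adj-sym G x y)
    (b2n-injective (trans (sym (agree z≢y (adjacent⇒≢ xz ∘ sym) (x≢y ∘ sym))) (cong b2n (trans (adj-sym G z x) xz))))

  -- A non-edge xy together with an edge xc: the exchange identity makes c the centre of a star.
  module StarCentre (exchange : EdgesExchange G) {x y c} (x≢y : x ≢ y) (xy : adj G x y ≡ false) (xc : adj G x c ≡ true) where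

    private
      c≢x : c ≢ x
      c≢x = adjacent⇒≢ xc ∘ sym
      c≢y : c ≢ y
      c≢y refl = case trans (sym xc) xy of λ ()
      cx : adj G c x ≡ true
      cx = trans (adj-sym G c x) xc
      yx : adj G y x ≡ false
      yx = trans (adj-sym G y x) xy

    like-x : ∀ t → t ≢ c → t ≢ y → adj G c t ≡ true × adj G y t ≡ false
    like-x t t≢c t≢y with t ≟ x
    ... | yes refl = cx , yx
    ... | no t≢x   = forced (exchange c≢y c≢x (t≢c ∘ sym) (x≢y ∘ sym) (t≢y ∘ sym) (t≢x ∘ sym))
      where
      forced : edge G c x + edge G y t ≡ edge G y x + edge G c t → adj G c t ≡ true × adj G y t ≡ false
      forced eq rewrite cx | yx with adj G c t | adj G y t
      ... | true  | false = refl , refl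
      ... | true  | true  = case eq of λ ()
      ... | false | _     = case eq of λ ()

    yc : adj G y c ≡ true
    yc with neighbour (c≢y ∘ sym)
    ... | t , yt with t ≟ c
    ...   | yes refl = yt
    ...   | no t≢c   = case trans (sym yt) (proj₂ (like-x t t≢c (adjacent⇒≢ yt ∘ sym))) of λ ()

    leaves : ∀ j → j ≢ c → adj G c j ≡ true
    leaves j j≢c with j ≟ y
    ... | yes refl = trans (adj-sym G c j) yc
    ... | no j≢y   = proj₁ (like-x j j≢c j≢y)

    no-other-edges : ∀ i j → i ≢ c → j ≢ c → adj G i j ≡ false
    no-other-edges i j i≢c j≢c with i ≟ j | i ≟ y | j ≟ y
    ... | yes refl | _        | _        = adj-irrefl G i
    ... | no i≢j   | yes refl | _        = proj₂ (like-x j j≢c (i≢j ∘ sym))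
    ... | no _     | no i≢y   | yes refl = trans (adj-sym G i j) (proj₂ (like-x i i≢c i≢y))
    ... | no i≢j   | no i≢y   | no j≢y   =
      isolated (exchange (i≢y ∘ sym) (c≢y ∘ sym) (j≢y ∘ sym) i≢c i≢j (j≢c ∘ sym))
      where
      isolated : edge G y c + edge G i j ≡ edge G i c + edge G y j → adj G i j ≡ false
      isolated eq rewrite yc | trans (adj-sym G i c) (leaves i i≢c) | proj₂ (like-x j j≢c j≢y) =
        b2n-injective (suc-injective eq)

  star-if-edges-exchange : EdgesExchange G → ∀ {x y} → x ≢ y → adj G x y ≡ false → ∃ (IsStarAt G)
  star-if-edges-exchange exchange x≢y xy with neighbour x≢y
  ... | c , xc = c , StarCentre.leaves exchange x≢y xy xc , StarCentre.no-other-edges exchange x≢y xy xc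

negEdgeEnds-complete : ∀ {n} (G : Graph n) → IsComplete G → ∀ P → negEdgeEnds G P ≡ #true P * #false P + #false P * #true P
negEdgeEnds-complete G complete P = trans (sumFin-cong row) (sumFin-if P (#false P) (#true P))
  where
  entry : ∀ i j → adj G i j ∧ (P i xor P j) ≡ (P i xor P j)
  entry i j with i ≟ j
  ... | yes refl rewrite xor-same (P i) = ∧-zeroʳ (adj G i i)
  ... | no i≢j   rewrite complete i j i≢j = refl
  row : ∀ i → crossDegree G P i (P i) ≡ (if P i then #false P else #true P)
  row i with P i | entry i
  ... | true  | entry-i = sumFin-cong (cong b2n ∘ entry-i)
  ... | false | entry-i = sumFin-cong (cong b2n ∘ entry-i)

negEdgeEnds-star : ∀ {n} (G : Graph n) {c} → IsStarAt G c → ∀ P →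
  negEdgeEnds G P ≡ countFin (λ j → P c xor P j) + countFin (λ j → P c xor P j)
negEdgeEnds-star G {c} (leaves , no-other-edges) P = +-cancelʳ-≡ 0 _ _ (begin
  negEdgeEnds G P + 0      ≡⟨ cong (negEdgeEnds G P +_) (cong b2n (xor-same (P c))) ⟨
  negEdgeEnds G P + away c ≡⟨ sumFin-agree-off c row-off-c ⟩
  K + row c                ≡⟨ cong (K +_) row-c ⟩
  K + K                    ≡⟨ +-identityʳ (K + K) ⟨
  K + K + 0                ∎)
  where
  away : Fin _ → ℕ
  away j = b2n (P c xor P j)
  K = sumFin away
  row : Fin _ → ℕ
  row i = crossDegree G P i (P i)
  row-off-c : ∀ i → i ≢ c → row i ≡ away i
  row-off-c i i≢c = begin
    row i
      ≡⟨ sumFin-single c (λ j j≢c → cong (λ a → b2n (a ∧ (P i xor P j))) (no-other-edges i j i≢c j≢c)) ⟩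
    b2n (adj G i c ∧ (P i xor P c))
      ≡⟨ cong (λ a → b2n (a ∧ (P i xor P c))) (trans (adj-sym G i c) (leaves i i≢c)) ⟩
    b2n (P i xor P c)
      ≡⟨ cong b2n (xor-comm (P i) (P c)) ⟩
    away i
      ∎
  row-c : row c ≡ K
  row-c = sumFin-cong λ j → cong b2n (entry j)
    where
    entry : ∀ j → adj G c j ∧ (P c xor P j) ≡ (P c xor P j)
    entry j with j ≟ c
    ... | yes refl rewrite xor-same (P j) = ∧-zeroʳ (adj G j j)
    ... | no j≢c   rewrite leaves j j≢c = refl

-- Graphs all of whose balanced cuts have the same size

shape-of-constant : ∀ {n} (G : Graph n) → Connected G → ConstantOnBalanced (negEdgeEnds G) →
  (G ≅ star n × 2 ∣ n) ⊎ G ≅ complete n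
shape-of-constant {n} G connected constant with parity n
... | inj₂ (k , n≡2k+1) = inj₂ (complete⇒≅complete G (complete-if-edges-agree G connected agree))
  where
  agree : EdgesAgree G
  agree u≢v u≢w v≢w =
    let R , bal , bal⁺ , Ru , Rv , Rw = odd-witness {k = k} n≡2k+1 (two-distinct⇒1≤k {k = k} n≡2k+1 u≢v) u≢v u≢w v≢w
    in edges-agree G constant u≢w v≢w Ru Rv Rw bal bal⁺
... | inj₁ (k , n≡2k) with missing-edge? G
...   | inj₁ complete = inj₂ (complete⇒≅complete G complete)
...   | inj₂ (x , y , x≢y , xy) =
  inj₁ (star⇒≅star G (proj₂ (star-if-edges-exchange G connected exchange x≢y xy)) , divides k (trans n≡2k (*-comm 2 k)))
  where
  exchange : EdgesExchange G
  exchange u≢v u≢w u≢x v≢w v≢x w≢x =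
    let P , bal , Pu , Pv , Pw , Px = separating-partition {k = k} n≡2k (three-distinct⇒2≤k {k = k} n≡2k u≢v u≢w v≢w)
                                        u≢v u≢w u≢x v≢w v≢x w≢x
        R , bal-w , bal-x , Ru , Rv , Rw , Rx = lowered-witness P u≢w v≢w w≢x bal Pu Pv Pw Px
    in edges-exchange G constant u≢w v≢w u≢x v≢x Ru Rv Rw Rx bal-w bal-x

constant-of-shape : ∀ {n} (G : Graph n) → (G ≅ star n × 2 ∣ n) ⊎ G ≅ complete n → ConstantOnBalanced (negEdgeEnds G)
constant-of-shape G (inj₂ G≅Kn) P Q balP balQ
  rewrite negEdgeEnds-complete G (≅complete⇒complete G G≅Kn) P | negEdgeEnds-complete G (≅complete⇒complete G G≅Kn) Q
  with balanced-counts P Q balP balQ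
... | inj₁ (t≡t , f≡f) rewrite t≡t | f≡f = refl
... | inj₂ (t≡f , f≡t) rewrite t≡f | f≡t = +-comm (#false Q * #true Q) (#true Q * #false Q)
constant-of-shape {zero}  G (inj₁ _) P Q _ _ = refl
constant-of-shape {suc m} G (inj₁ (G≅star , divides k n≡k*2)) P Q balP balQ with ≅star⇒star G G≅star
... | c , star rewrite negEdgeEnds-star G star P | negEdgeEnds-star G star Q =
  cong (λ t → t + t) (trans (opposite-centre P balP) (sym (opposite-centre Q balQ)))
  where
  opposite-centre : ∀ R → Balanced R → countFin (λ j → R c xor R j) ≡ k
  opposite-centre R balR with R c | balanced-even {k = k} R (trans n≡k*2 (*-comm k 2)) balR
  ... | true  | _ , f≡k = f≡k
  ... | false | t≡k , _ = t≡k

-- The rna number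

negEdges≤edgeCount : ∀ {n} (G : Graph n) P → negEdges G P ≤ edgeCount G
negEdges≤edgeCount G P = sumFin-mono λ i → sumFin-mono λ j → entry (toℕ i <ᵇ toℕ j) (adj G i j) (P i xor P j)
  where
  entry : ∀ a b x → b2n (a ∧ (b ∧ x)) ≤ b2n (a ∧ b)
  entry true  true  true  = ≤-refl
  entry true  true  false = z≤n
  entry true  false _     = z≤n
  entry false _     _     = z≤n

allVecs-complete : ∀ n (v : Vec Bool n) → v ∈ allVecs n
allVecs-complete zero    Vec.[]          = here refl
allVecs-complete (suc n) (true Vec.∷ v)  = ∈-++⁺ˡ (∈-map⁺ (true Vec.∷_) (allVecs-complete n v))
allVecs-complete (suc n) (false Vec.∷ v) =
  ∈-++⁺ʳ (map (true Vec.∷_) (allVecs n)) (∈-map⁺ (false Vec.∷_) (allVecs-complete n v))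

balanced?-sound : ∀ {n} (v : Vec Bool n) → balanced? v ≡ true → Balanced (lookup v)
balanced?-sound v accepted
  with countFin (lookup v) ≤? countFin (λ i → not (lookup v i)) + 1 | countFin (λ i → not (lookup v i)) ≤? countFin (lookup v) + 1
balanced?-sound v refl | yes t≤f+1 | yes f≤t+1 = t≤f+1 , f≤t+1

balanced?-complete : ∀ {n} (v : Vec Bool n) → Balanced (lookup v) → balanced? v ≡ true
balanced?-complete v (t≤f+1 , f≤t+1)
  with countFin (lookup v) ≤? countFin (λ i → not (lookup v i)) + 1 | countFin (λ i → not (lookup v i)) ≤? countFin (lookup v) + 1
... | yes _    | yes _    = refl
... | no t≰f+1 | _        = ⊥-elim (t≰f+1 t≤f+1)
... | yes _    | no f≰t+1 = ⊥-elim (f≰t+1 f≤t+1)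

rna-of-constant : ∀ {n} (G : Graph n) (P₀ : Partition n) → Balanced P₀ →
  (∀ P → Balanced P → negEdges G P ≡ negEdges G P₀) → rna G ≡ negEdges G P₀
rna-of-constant {n} G P₀ bal₀ constant = ≤-antisym
  (foldr-preservesᵒ {P = _≤ negEdges G P₀} (λ a b → [ m≤n⇒m⊓o≤n b , m≤n⇒o⊓m≤n a ]′)
    (edgeCount G) (map value candidates) (inj₂ (Any.map⁺ attained)))
  (foldr-preservesᵇ {P = negEdges G P₀ ≤_} ⊓-glb (negEdges≤edgeCount G P₀) (All.map⁺ bounds))
  where
  accept = λ (v : Vec Bool n) → balanced? v Bool.≟ true
  candidates = filter accept (allVecs n)
  value : Vec Bool n → ℕ
  value v = negEdges G (lookup v)
  bounded : ∀ {v} → balanced? v ≡ true → negEdges G P₀ ≤ value v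
  bounded {v} accepted = ≤-reflexive (sym (constant (lookup v) (balanced?-sound v accepted)))
  bounds : All.All (λ v → negEdges G P₀ ≤ value v) candidates
  bounds = All.map (λ {v} → bounded {v}) (All.all-filter accept (allVecs n))
  v₀ = tabulate P₀
  bal-v₀ : Balanced (lookup v₀)
  bal-v₀ = balanced-cong (sym ∘ lookup∘tabulate P₀) bal₀
  attained : Any (λ v → value v ≤ negEdges G P₀) candidates
  attained = Any.map (λ { refl → ≤-reflexive (constant (lookup v₀) bal-v₀) })
    (∈-filter⁺ accept (allVecs-complete n v₀) (balanced?-complete v₀ bal-v₀))

singleton-Σ⁻⇔constant : ∀ {n} (G : Graph n) → (∀ k → InΣ⁻ G k ⇔ (k ≡ rna G)) ⇔ ConstantOnBalanced (negEdges G)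
singleton-Σ⁻⇔constant {n} G = mk⇔
  (λ singleton P Q balP balQ → trans (at-rna singleton P balP) (sym (at-rna singleton Q balQ)))
  (λ constant k → mk⇔
    (λ { (P , balP , refl) → trans (constant P alternating balP bal₀) (sym (rna≡ constant)) })
    (λ { refl → alternating , bal₀ , sym (rna≡ constant) }))
  where
  bal₀ = alternating-balanced n
  at-rna : (∀ k → InΣ⁻ G k ⇔ (k ≡ rna G)) → ∀ P → Balanced P → negEdges G P ≡ rna G
  at-rna singleton P balP = Equivalence.to (singleton (negEdges G P)) (P , balP , refl)
  rna≡ : ConstantOnBalanced (negEdges G) → rna G ≡ negEdges G alternating
  rna≡ constant = rna-of-constant G alternating bal₀ λ P balP → constant P alternating balP bal₀

constant-negEdges⇔negEdgeEnds : ∀ {n} (G : Graph n) → ConstantOnBalanced (negEdges G) ⇔ ConstantOnBalanced (negEdgeEnds G)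
constant-negEdges⇔negEdgeEnds G = mk⇔
  (λ constant P Q balP balQ →
    trans (sym (negEdges-double G P)) (trans (cong (λ t → t + t) (constant P Q balP balQ)) (negEdges-double G Q)))
  (λ constant P Q balP balQ →
    double-injective (trans (negEdges-double G P) (trans (constant P Q balP balQ) (sym (negEdges-double G Q)))))

mainTheorem1 : (n : ℕ) (G : Graph n) → Connected G →
    ((∀ (k : ℕ) → InΣ⁻ G k ⇔ (k ≡ rna G))
    ⇔ ((G ≅ star n × 2 ∣ n) ⊎ G ≅ complete n))
mainTheorem1 n G connected = mk⇔
  (shape-of-constant G connected ∘ Equivalence.to (constant-negEdges⇔negEdgeEnds G) ∘ Equivalence.to (singleton-Σ⁻⇔constant G))
  (Equivalence.from (singleton-Σ⁻⇔constant G) ∘ Equivalence.from (constant-negEdges⇔negEdgeEnds G) ∘ constant-of-shape G)
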